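{- Fix positive integers $n$ and $m_0<n$. Then for all $0\le h\le m_0-1$, \[ (h+1)\,e_{n-m_0-1}(x_1,\dots,x_n)=\sum_{a=m_0-h}^{n-1}\ \sum_{j=1}^{n-a}e_{h-m_0+a}(x_{j+1},\dots,x_{j+a-1})\; e_{n-h-1-a}(x_{j+a+1},\dots,x_n,x_1,\dots,x_{j-1}). \]
   Context: $e_k(y_1,\dots,y_p)$ denotes the elementary symmetric polynomial of degree $k$ in the listed variables, with $e_0=1$ and $e_k=0$ if $k<0$ or $k$ exceeds the number of variables. The variable list $x_{j+a+1},\dots,x_n$ is empty when $j+a=n$, and $x_{j+1},\dots,x_{j+a-1}$ is empty when $a=1$. -}

module Defs where

open import Level using (Level)
open import Algebra.Bundles using (CommutativeRing)
open import Data.Nat using (ℕ; zero; suc; _∸_; _<?_) renaming (_+_ to _+ℕ_)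
open import Data.Integer using (ℤ; +_; -[1+_])
open import Data.Fin using (Fin; fromℕ<)
open import Data.List using (List; []; _∷_; map; upTo; foldr)
open import Relation.Nullary using (yes; no)

[_⋯_] : ℕ → ℕ → List ℕ
[ i ⋯ j ] = map (i +ℕ_) (upTo (suc j ∸ i))

module _ {c ℓ : Level} (R : CommutativeRing c ℓ) where
  open CommutativeRing R

  esym : ℕ → List Carrier → Carrier
  esym zero    _        = 1#
  esym (suc k) []       = 0#
  esym (suc k) (y ∷ ys) = y * esym k ys + esym (suc k) ys

  esymℤ : ℤ → List Carrier → Carrier
  esymℤ (+ k)    ys = esym k ys
  esymℤ -[1+ _ ] ys = 0#

  -- 1-based access x_i for x : Fin n → Carrier (values outside 1..n are never used)
  at : {n : ℕ} → (Fin n → Carrier) → ℕ → Carrier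
  at {n} x zero = 0#
  at {n} x (suc i) with i <? n
  ... | yes p = x (fromℕ< p)
  ... | no _  = 0#

  xs[_⋯_] : {n : ℕ} → (Fin n → Carrier) → ℕ → ℕ → List Carrier
  xs[_⋯_] x i j = map (at x) [ i ⋯ j ]

  ∑[_⋯_] : ℕ → ℕ → (ℕ → Carrier) → Carrier
  ∑[ i ⋯ j ] f = foldr (λ k acc → f k + acc) 0# [ i ⋯ j ]

  _·_ : ℕ → Carrier → Carrier
  zero  · y = 0#
  suc k · y = y + k · y

{-# OPTIONS --safe #-}

-- Let coesym c ys be the elementary symmetric polynomial of co-degree c: the sum, over all ways
-- of deleting c entries of ys, of the product of the remaining ones. Put m₀ = h + r + 1 and
-- L = x₁ … xₙ. The entries x_j and x_{j+a} cut L into the segment between them and the cyclic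
-- rest, and the (a, j) summand is coesym r (between) · coesym h (rest). Splitting the rest at
-- the seam xₙ | x₁ turns the second factor into ∑_{i ≤ h} coesym i (after) · coesym (h − i) (before).
-- Summed over the two cut positions, coesym (h − i) (before) · coesym r (between) · coesym i (after)
-- runs exactly once through every deletion of h + r + 2 entries of L, the cuts being the
-- (h − i + 1)-st and (h − i + r + 2)-nd deleted entries; so each of the h + 1 values of i contributes
-- coesym (h + r + 2) L = e_{n−m₀−1}. Summands with a ≤ r vanish, the middle segment then being
-- too short, which is why the outer sum may start at a = m₀ − h.

module Submission where

open import Defs
open import Level using (Level)
open import Algebra.Bundles using (CommutativeRing)
open import Data.Nat using (ℕ; suc; _∸_; _≤_; _<_) renaming (_+_ to _+ℕ_)
open import Data.Integer using (+_) renaming (_-_ to _-ℤ_)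
open import Data.Fin using (Fin)
open import Data.List using (_++_)

open import Data.Nat using (zero; z≤n; s≤s; z<s)
import Data.Nat.Properties as ℕₚ
open import Data.Nat.Tactic.RingSolver using (solve-∀)
open import Data.Integer using (_⊖_)
open import Data.Integer.Properties using (m-n≡m⊖n; [1+m]⊖[1+n]≡m⊖n)
open import Data.Fin using (toℕ)
open import Data.Fin.Properties using (toℕ<n)
open import Data.List using (List; []; _∷_; map; take; drop; length; applyUpTo; upTo; foldr)
open import Data.List.Properties
  using (length-map; length-upTo; length-++; length-drop; length-take)
open import Data.List.Properties using (take-map; drop-map; drop-drop; map-upTo; map-cong; map-∘)
open import Data.Product using (∃; _,_)
open import Function using (_∘_; id)
open import Relation.Binary.PropositionalEquality as ≡ using (_≡_)

module _ {a} {A : Set a} where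

  take-applyUpTo : ∀ (g : ℕ → A) {k m} → k ≤ m → take k (applyUpTo g m) ≡ applyUpTo g k
  take-applyUpTo g {zero}  _         = ≡.refl
  take-applyUpTo g {suc k} (s≤s k≤m) = ≡.cong (g 0 ∷_) (take-applyUpTo (g ∘ suc) k≤m)

  drop-applyUpTo : ∀ (g : ℕ → A) d m → drop d (applyUpTo g m) ≡ applyUpTo (g ∘ (d +ℕ_)) (m ∸ d)
  drop-applyUpTo g zero    m       = ≡.refl
  drop-applyUpTo g (suc d) zero    = ≡.refl
  drop-applyUpTo g (suc d) (suc m) = drop-applyUpTo (g ∘ suc) d m

module _ where
  open ≡.≡-Reasoning

  take-⋯ : ∀ {i j l k} → suc l ≡ i +ℕ k → l ≤ j → take k [ i ⋯ j ] ≡ [ i ⋯ l ]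
  take-⋯ {i} {j} {l} {k} eq l≤j = begin
      take k (map (i +ℕ_) (upTo (suc j ∸ i)))  ≡⟨ take-map k (upTo (suc j ∸ i)) ⟩
      map (i +ℕ_) (take k (upTo (suc j ∸ i)))  ≡⟨ ≡.cong (map (i +ℕ_)) (take-applyUpTo id k≤) ⟩
      map (i +ℕ_) (upTo k)                     ≡⟨ ≡.cong (map (i +ℕ_) ∘ upTo) (≡.sym size) ⟩
      [ i ⋯ l ]                                ∎
    where
    size : suc l ∸ i ≡ k
    size = ≡.trans (≡.cong (_∸ i) eq) (ℕₚ.m+n∸m≡n i k)
    k≤ : k ≤ suc j ∸ i
    k≤ = ≡.subst (_≤ suc j ∸ i) size (ℕₚ.∸-monoˡ-≤ i (s≤s l≤j))

  drop-⋯ : ∀ d i j → drop d [ i ⋯ j ] ≡ [ d +ℕ i ⋯ j ]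
  drop-⋯ d i j = begin
      drop d (map (i +ℕ_) (upTo m))             ≡⟨ drop-map d (upTo m) ⟩
      map (i +ℕ_) (drop d (upTo m))             ≡⟨ ≡.cong (map (i +ℕ_)) (drop-applyUpTo id d m) ⟩
      map (i +ℕ_) (applyUpTo (d +ℕ_) (m ∸ d))   ≡⟨ ≡.cong (map (i +ℕ_)) (≡.sym (map-upTo (d +ℕ_) (m ∸ d))) ⟩
      map (i +ℕ_) (map (d +ℕ_) (upTo (m ∸ d)))  ≡⟨ ≡.sym (map-∘ (upTo (m ∸ d))) ⟩
      map ((i +ℕ_) ∘ (d +ℕ_)) (upTo (m ∸ d))    ≡⟨ map-cong (shift i d) (upTo (m ∸ d)) ⟩
      map (d +ℕ i +ℕ_) (upTo (m ∸ d))           ≡⟨ ≡.cong (map (d +ℕ i +ℕ_) ∘ upTo) size ⟩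
      [ d +ℕ i ⋯ j ]                            ∎
    where
    m = suc j ∸ i
    shift : ∀ i d u → i +ℕ (d +ℕ u) ≡ d +ℕ i +ℕ u
    shift = solve-∀
    size : m ∸ d ≡ suc j ∸ (d +ℕ i)
    size = ≡.trans (ℕₚ.∸-+-assoc (suc j) i d) (≡.cong (suc j ∸_) (ℕₚ.+-comm i d))

module _ {a} {A : Set a} (f : ℕ → A) where
  open ≡.≡-Reasoning

  length-map-⋯ : ∀ {i j k} → suc j ≡ i +ℕ k → length (map f [ i ⋯ j ]) ≡ k
  length-map-⋯ {i} {j} {k} eq = begin
      length (map f [ i ⋯ j ])    ≡⟨ length-map f [ i ⋯ j ] ⟩
      length [ i ⋯ j ]            ≡⟨ length-map (i +ℕ_) (upTo (suc j ∸ i)) ⟩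
      length (upTo (suc j ∸ i))   ≡⟨ length-upTo (suc j ∸ i) ⟩
      suc j ∸ i                   ≡⟨ ≡.cong (_∸ i) eq ⟩
      i +ℕ k ∸ i                  ≡⟨ ℕₚ.m+n∸m≡n i k ⟩
      k                           ∎

  take-map-⋯ : ∀ {i j l k} → suc l ≡ i +ℕ k → l ≤ j → take k (map f [ i ⋯ j ]) ≡ map f [ i ⋯ l ]
  take-map-⋯ {k = k} eq l≤j = ≡.trans (take-map k _) (≡.cong (map f) (take-⋯ eq l≤j))

  drop-map-⋯ : ∀ d i j → drop d (map f [ i ⋯ j ]) ≡ map f [ d +ℕ i ⋯ j ]
  drop-map-⋯ d i j = ≡.trans (drop-map d _) (≡.cong (map f) (drop-⋯ d i j))

m<n∸o⇒∃[w]n≡m+[1+o]+w : ∀ {n} p b → p < n ∸ b → ∃ λ w → n ≡ p +ℕ suc b +ℕ w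
m<n∸o⇒∃[w]n≡m+[1+o]+w p zero p<n with ℕₚ.m≤n⇒∃[o]m+o≡n p<n
... | w , ≡.refl = w , shift p w
  where
  shift : ∀ p w → suc p +ℕ w ≡ p +ℕ 1 +ℕ w
  shift = solve-∀
m<n∸o⇒∃[w]n≡m+[1+o]+w {zero}  p (suc b) ()
m<n∸o⇒∃[w]n≡m+[1+o]+w {suc n} p (suc b) p< with m<n∸o⇒∃[w]n≡m+[1+o]+w p b p<
... | w , ≡.refl = w , ≡.cong (_+ℕ w) (≡.sym (ℕₚ.+-suc p (suc b)))

m<n⇒1+n≡2+m+[n∸m∸1] : ∀ {m n} → m < n → suc n ≡ suc (suc m) +ℕ (n ∸ m ∸ 1)
m<n⇒1+n≡2+m+[n∸m∸1] {zero}  (s≤s z≤n) = ≡.refl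
m<n⇒1+n≡2+m+[n∸m∸1] {suc m} (s≤s m<n) = ≡.cong suc (m<n⇒1+n≡2+m+[n∸m∸1] m<n)

module ElementarySymmetric {c ℓ : Level} (R : CommutativeRing c ℓ) where
  open CommutativeRing R hiding (zero)
  open import Algebra.Properties.Semiring.Sum semiring
    using (sum; sum-cong-≋; sum-replicate-zero; ∑-distrib-+; ∑-comm; *-distribˡ-sum)
  open import Algebra.Properties.CommutativeSemigroup +-commutativeSemigroup using (interchange)
  open import Relation.Binary.Reasoning.Setoid setoid

  ∑< : ℕ → (ℕ → Carrier) → Carrier
  ∑< k g = sum {k} (g ∘ toℕ)

  ∑<-cong : ∀ k {g g′ : ℕ → Carrier} → (∀ t → t < k → g t ≈ g′ t) → ∑< k g ≈ ∑< k g′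
  ∑<-cong k eq = sum-cong-≋ (λ i → eq (toℕ i) (toℕ<n i))

  ∑<-zero : ∀ k {g : ℕ → Carrier} → (∀ t → t < k → g t ≈ 0#) → ∑< k g ≈ 0#
  ∑<-zero k eq = trans (∑<-cong k eq) (sum-replicate-zero k)

  ∑<-distrib-+ : ∀ k (g g′ : ℕ → Carrier) → ∑< k (λ t → g t + g′ t) ≈ ∑< k g + ∑< k g′
  ∑<-distrib-+ k g g′ = ∑-distrib-+ {k} (g ∘ toℕ) (g′ ∘ toℕ)

  *-distribˡ-∑< : ∀ k x (g : ℕ → Carrier) → x * ∑< k g ≈ ∑< k (λ t → x * g t)
  *-distribˡ-∑< k x g = *-distribˡ-sum {k} x (g ∘ toℕ)

  ∑<-comm : ∀ k m (g : ℕ → ℕ → Carrier) → ∑< k (λ a → ∑< m (g a)) ≈ ∑< m (λ b → ∑< k (λ a → g a b))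
  ∑<-comm k m g = ∑-comm {k} {m} (λ a b → g (toℕ a) (toℕ b))

  ∑<-const : ∀ k x → ∑< k (λ _ → x) ≈ _·_ R k x
  ∑<-const zero    x = refl
  ∑<-const (suc k) x = +-congˡ (∑<-const k x)

  ·-congʳ : ∀ k {x y} → x ≈ y → _·_ R k x ≈ _·_ R k y
  ·-congʳ zero    _   = refl
  ·-congʳ (suc k) x≈y = +-cong x≈y (·-congʳ k x≈y)

  ∑<-skip-zeros : ∀ {r k} (g : ℕ → Carrier) → r ≤ k → (∀ b → b < r → g b ≈ 0#) →
                  ∑< k g ≈ ∑< (k ∸ r) (λ t → g (r +ℕ t))
  ∑<-skip-zeros g z≤n       _     = refl
  ∑<-skip-zeros g (s≤s r≤k) zeros =
    trans (+-cong (zeros 0 z<s) (∑<-skip-zeros (g ∘ suc) r≤k (λ b b<r → zeros (suc b) (s≤s b<r))))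
          (+-identityˡ _)

  ∑<-pullˡ : ∀ k y (u w : ℕ → Carrier) → ∑< k (λ t → y * u t * w t) ≈ y * ∑< k (λ t → u t * w t)
  ∑<-pullˡ k y u w =
    trans (∑<-cong k (λ t _ → *-assoc y (u t) (w t))) (sym (*-distribˡ-∑< k y (λ t → u t * w t)))

  ∑<-affine : ∀ k y (u v w : ℕ → Carrier) →
              ∑< k (λ t → (y * u t + v t) * w t) ≈ y * ∑< k (λ t → u t * w t) + ∑< k (λ t → v t * w t)
  ∑<-affine k y u v w = begin
      ∑< k (λ t → (y * u t + v t) * w t)
    ≈⟨ ∑<-cong k (λ t _ → distribʳ (w t) (y * u t) (v t)) ⟩
      ∑< k (λ t → y * u t * w t + v t * w t)
    ≈⟨ ∑<-distrib-+ k (λ t → y * u t * w t) (λ t → v t * w t) ⟩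
      ∑< k (λ t → y * u t * w t) + ∑< k (λ t → v t * w t)
    ≈⟨ +-congʳ (∑<-pullˡ k y u w) ⟩
      y * ∑< k (λ t → u t * w t) + ∑< k (λ t → v t * w t)
    ∎

  ∑△ : ℕ → (ℕ → ℕ → Carrier) → Carrier
  ∑△ k G = ∑< k (λ b → ∑< (k ∸ b) (G b))

  ∑△-column : ∀ k (G : ℕ → ℕ → Carrier) →
              ∑△ (suc k) G ≈ ∑< (suc k) (λ b → G b 0) + ∑△ k (λ b p → G b (suc p))
  ∑△-column zero    G = refl
  ∑△-column (suc k) G = trans (+-congˡ (∑△-column k (G ∘ suc))) (interchange _ _ _ _)

  ∑△-transpose : ∀ k (G : ℕ → ℕ → Carrier) → ∑△ k G ≈ ∑△ k (λ p b → G b p)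
  ∑△-transpose zero    G = refl
  ∑△-transpose (suc k) G = trans (∑△-column k G) (+-congˡ (∑△-transpose k (λ b p → G b (suc p))))

  ∑△-extra-row : ∀ k (G : ℕ → ℕ → Carrier) → ∑< (suc k) (λ p → ∑< (k ∸ p) (G p)) ≈ ∑△ k G
  ∑△-extra-row zero    G = +-identityʳ 0#
  ∑△-extra-row (suc k) G = +-congˡ (∑△-extra-row k (G ∘ suc))

  -- coesym c ys = e_{|ys| − c}(ys), and 0 when c > |ys|.
  coesym : ℕ → List Carrier → Carrier
  coesym zero    []       = 1#
  coesym (suc c) []       = 0#
  coesym zero    (y ∷ ys) = y * coesym zero ys
  coesym (suc c) (y ∷ ys) = y * coesym (suc c) ys + coesym c ys

  coesym-short : ∀ c ys → length ys < c → coesym c ys ≈ 0#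
  coesym-short (suc c) []       _          = refl
  coesym-short (suc c) (y ∷ ys) (s≤s ys<c) =
    trans (+-cong (trans (*-congˡ (coesym-short (suc c) ys (ℕₚ.m<n⇒m<1+n ys<c))) (zeroʳ y))
                  (coesym-short c ys ys<c))
          (+-identityʳ 0#)

  esym-short : ∀ d ys → length ys < d → esym R d ys ≈ 0#
  esym-short (suc d) []       _          = refl
  esym-short (suc d) (y ∷ ys) (s≤s ys<d) =
    trans (+-cong (trans (*-congˡ (esym-short d ys ys<d)) (zeroʳ y))
                  (esym-short (suc d) ys (ℕₚ.m<n⇒m<1+n ys<d)))
          (+-identityʳ 0#)

  coesym-length : ∀ ys → coesym (length ys) ys ≈ 1#
  coesym-length []       = refl
  coesym-length (y ∷ ys) =
    trans (+-cong (trans (*-congˡ (coesym-short _ ys ℕₚ.≤-refl)) (zeroʳ y)) (coesym-length ys))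
          (+-identityˡ 1#)

  esym≈coesym : ∀ ys c d → length ys ≡ c +ℕ d → esym R d ys ≈ coesym c ys
  esym≈coesym ys       c       zero    eq =
    sym (≡.subst (λ k → coesym k ys ≈ 1#) (≡.trans eq (ℕₚ.+-identityʳ c)) (coesym-length ys))
  esym≈coesym []       zero    (suc d) ()
  esym≈coesym []       (suc c) (suc d) ()
  esym≈coesym (y ∷ ys) zero    (suc d) eq =
    trans (+-cong (*-congˡ (esym≈coesym ys zero d eq′)) (esym-short (suc d) ys (s≤s (ℕₚ.≤-reflexive eq′))))
          (+-identityʳ _)
    where eq′ = ℕₚ.suc-injective eq
  esym≈coesym (y ∷ ys) (suc c) (suc d) eq =
    +-cong (*-congˡ (esym≈coesym ys (suc c) d (≡.trans eq′ (ℕₚ.+-suc c d)))) (esym≈coesym ys c (suc d) eq′)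
    where eq′ = ℕₚ.suc-injective eq

  esymℤ-⊖≈coesym : ∀ ys m k c → length ys +ℕ k ≡ m +ℕ c → esymℤ R (m ⊖ k) ys ≈ coesym c ys
  esymℤ-⊖≈coesym ys m       zero    c eq =
    esym≈coesym ys c m (≡.trans (≡.sym (ℕₚ.+-identityʳ _)) (≡.trans eq (ℕₚ.+-comm m c)))
  esymℤ-⊖≈coesym ys zero    (suc k) c eq =
    sym (coesym-short c ys (≡.subst (length ys <_) eq (ℕₚ.m<m+n (length ys) z<s)))
  esymℤ-⊖≈coesym ys (suc m) (suc k) c eq =
    ≡.subst (λ z → esymℤ R z ys ≈ coesym c ys) (≡.sym ([1+m]⊖[1+n]≡m⊖n m k))
      (esymℤ-⊖≈coesym ys m k c (ℕₚ.suc-injective (≡.trans (≡.sym (ℕₚ.+-suc (length ys) k)) eq)))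

  esymℤ≈coesym : ∀ ys {m k c} → length ys +ℕ k ≡ m +ℕ c → esymℤ R (+ m -ℤ + k) ys ≈ coesym c ys
  esymℤ≈coesym ys {m} {k} {c} eq =
    ≡.subst (λ z → esymℤ R z ys ≈ coesym c ys) (≡.sym (m-n≡m⊖n m k)) (esymℤ-⊖≈coesym ys m k c eq)

  coesym-++ : ∀ h (A B : List Carrier) →
              coesym h (A ++ B) ≈ ∑< (suc h) (λ i → coesym i A * coesym (h ∸ i) B)
  coesym-++ h       []      B =
    sym (trans (+-cong (*-identityˡ _) (∑<-zero h (λ t _ → zeroˡ (coesym (h ∸ suc t) B)))) (+-identityʳ _))
  coesym-++ zero    (y ∷ A) B =
    trans (*-congˡ (coesym-++ zero A B)) (sym (∑<-pullˡ 1 y (λ i → coesym i A) (λ i → coesym (0 ∸ i) B)))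
  coesym-++ (suc h) (y ∷ A) B = begin
      y * coesym (suc h) (A ++ B) + coesym h (A ++ B)
    ≈⟨ +-cong (*-congˡ (coesym-++ (suc h) A B)) (coesym-++ h A B) ⟩
      y * (a₀ + ∑< (suc h) (λ i → u i * w i)) + ∑< (suc h) (λ i → v i * w i)
    ≈⟨ trans (+-congʳ (distribˡ y a₀ _)) (+-assoc _ _ _) ⟩
      y * a₀ + (y * ∑< (suc h) (λ i → u i * w i) + ∑< (suc h) (λ i → v i * w i))
    ≈⟨ +-cong (sym (*-assoc y _ _)) (sym (∑<-affine (suc h) y u v w)) ⟩
      y * coesym 0 A * coesym (suc h) B + ∑< (suc h) (λ i → (y * u i + v i) * w i)
    ∎
    where
    a₀ = coesym 0 A * coesym (suc h) B
    u v w : ℕ → Carrier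
    u i = coesym (suc i) A
    v i = coesym i A
    w i = coesym (h ∸ i) B

  -- b is the position of the (r + 1)-st deleted entry.
  coesym-one-gap : ∀ r c L →
    ∑< (length L) (λ b → coesym r (take b L) * coesym c (drop (suc b) L)) ≈ coesym (suc (r +ℕ c)) L
  coesym-one-gap r       c []      = refl
  coesym-one-gap zero    c (y ∷ L) = begin
      1# * coesym c L + ∑< (length L) (λ b → y * coesym 0 (take b L) * rest b)
    ≈⟨ +-cong (*-identityˡ _) (∑<-pullˡ (length L) y (λ b → coesym 0 (take b L)) rest) ⟩
      coesym c L + y * ∑< (length L) (λ b → coesym 0 (take b L) * rest b)
    ≈⟨ trans (+-comm _ _) (+-congʳ (*-congˡ (coesym-one-gap 0 c L))) ⟩
      y * coesym (suc c) L + coesym c L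
    ∎
    where
    rest : ℕ → Carrier
    rest b = coesym c (drop (suc b) L)
  coesym-one-gap (suc r) c (y ∷ L) = begin
      0# * coesym c L + ∑< (length L) (λ b → (y * u b + v b) * rest b)
    ≈⟨ trans (+-congʳ (zeroˡ _)) (+-identityˡ _) ⟩
      ∑< (length L) (λ b → (y * u b + v b) * rest b)
    ≈⟨ ∑<-affine (length L) y u v rest ⟩
      y * ∑< (length L) (λ b → u b * rest b) + ∑< (length L) (λ b → v b * rest b)
    ≈⟨ +-cong (*-congˡ (coesym-one-gap (suc r) c L)) (coesym-one-gap r c L) ⟩
      y * coesym (suc (suc r +ℕ c)) L + coesym (suc (r +ℕ c)) L
    ∎
    where
    u v rest : ℕ → Carrier
    u b    = coesym (suc r) (take b L)
    v b    = coesym r (take b L)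
    rest b = coesym c (drop (suc b) L)

  -- The entries at positions p and p + 1 + b (counting from 0) cut L into three segments.
  gapProduct : ℕ → ℕ → ℕ → List Carrier → ℕ → ℕ → Carrier
  gapProduct j r i L p b =
    coesym j (take p L) * (coesym r (take b (drop (suc p) L)) * coesym i (drop (suc b) (drop (suc p) L)))

  gapProduct-short : ∀ j r i L p {b} → b < r → gapProduct j r i L p b ≈ 0#
  gapProduct-short j r i L p {b} b<r = trans (*-congˡ (trans (*-congʳ middle≈0) (zeroˡ _))) (zeroʳ _)
    where
    middle≈0 : coesym r (take b (drop (suc p) L)) ≈ 0#
    middle≈0 = coesym-short r _
      (ℕₚ.≤-<-trans (≡.subst (_≤ b) (≡.sym (length-take b (drop (suc p) L))) (ℕₚ.m⊓n≤m b _)) b<r)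

  coesym-two-gaps : ∀ j r i L {k} → length L ≡ suc k →
                    ∑△ k (gapProduct j r i L) ≈ coesym (suc (j +ℕ suc (r +ℕ i))) L
  coesym-two-gaps j r i L {k} len = begin
      ∑△ k (gapProduct j r i L)                            ≈⟨ sym (∑△-extra-row k (gapProduct j r i L)) ⟩
      ∑< (suc k) (λ p → ∑< (k ∸ p) (gapProduct j r i L p))  ≈⟨ ∑<-cong (suc k) (λ p _ → second-gap p) ⟩
      ∑< (suc k) first-gap                                  ≡⟨ ≡.cong (λ m → ∑< m first-gap) (≡.sym len) ⟩
      ∑< (length L) first-gap                               ≈⟨ coesym-one-gap j (suc (r +ℕ i)) L ⟩
      coesym (suc (j +ℕ suc (r +ℕ i))) L                    ∎
    where
    first-gap : ℕ → Carrier
    first-gap p = coesym j (take p L) * coesym (suc (r +ℕ i)) (drop (suc p) L)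

    second-gap : ∀ p → ∑< (k ∸ p) (gapProduct j r i L p) ≈ first-gap p
    second-gap p = begin
        ∑< (k ∸ p) (gapProduct j r i L p)       ≈⟨ sym (*-distribˡ-∑< (k ∸ p) (coesym j (take p L)) gap) ⟩
        coesym j (take p L) * ∑< (k ∸ p) gap    ≡⟨ ≡.cong (λ m → coesym j (take p L) * ∑< m gap) (≡.sym length-M) ⟩
        coesym j (take p L) * ∑< (length M) gap ≈⟨ *-congˡ (coesym-one-gap r i M) ⟩
        first-gap p                             ∎
      where
      M = drop (suc p) L
      gap : ℕ → Carrier
      gap b = coesym r (take b M) * coesym i (drop (suc b) M)
      length-M : length M ≡ k ∸ p
      length-M = ≡.trans (length-drop (suc p) L) (≡.cong (_∸ suc p) len)

  ∑-gapProduct≈·coesym : ∀ h r L {k} → length L ≡ suc k →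
    ∑< (suc h) (λ i → ∑△ k (λ b p → gapProduct (h ∸ i) r i L p b))
      ≈ _·_ R (suc h) (coesym (suc (suc (h +ℕ r))) L)
  ∑-gapProduct≈·coesym h r L {k} len = begin
      ∑< (suc h) (λ i → ∑△ k (λ b p → gapProduct (h ∸ i) r i L p b))
    ≈⟨ ∑<-cong (suc h) (λ i i<1+h → trans (∑△-transpose k (λ b p → gapProduct (h ∸ i) r i L p b))
                                    (trans (coesym-two-gaps (h ∸ i) r i L len)
                                           (reflexive (≡.cong (λ d → coesym (suc d) L) (degree i<1+h))))) ⟩
      ∑< (suc h) (λ _ → coesym (suc (suc (h +ℕ r))) L)
    ≈⟨ ∑<-const (suc h) _ ⟩
      _·_ R (suc h) (coesym (suc (suc (h +ℕ r))) L)
    ∎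
    where
    regroup : ∀ x r i → x +ℕ suc (r +ℕ i) ≡ suc (x +ℕ i +ℕ r)
    regroup = solve-∀
    degree : ∀ {i} → i < suc h → h ∸ i +ℕ suc (r +ℕ i) ≡ suc (h +ℕ r)
    degree {i} (s≤s i≤h) = ≡.trans (regroup (h ∸ i) r i) (≡.cong (λ x → suc (x +ℕ r)) (ℕₚ.m∸n+n≡m i≤h))

  ∑⋯≡∑< : ∀ s e (G : ℕ → Carrier) → ∑[_⋯_] R s e G ≡ ∑< (suc e ∸ s) (λ t → G (s +ℕ t))
  ∑⋯≡∑< s e G = ≡.trans (≡.cong (foldr (λ k acc → G k + acc) 0#) (map-upTo (s +ℕ_) (suc e ∸ s)))
                        (foldr-applyUpTo (s +ℕ_) (suc e ∸ s))
    where
    foldr-applyUpTo : ∀ (g : ℕ → ℕ) m → foldr (λ k acc → G k + acc) 0# (applyUpTo g m) ≡ ∑< m (G ∘ g)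
    foldr-applyUpTo g zero    = ≡.refl
    foldr-applyUpTo g (suc m) = ≡.cong (λ rest → G (g 0) + rest) (foldr-applyUpTo (g ∘ suc) m)

  ∑⋯∑⋯≈∑<∑< : ∀ n s (T : ℕ → ℕ → Carrier) →
    ∑[_⋯_] R (suc s) n (λ a → ∑[_⋯_] R 1 (suc n ∸ a) (T a))
      ≈ ∑< (n ∸ s) (λ t → ∑< (n ∸ (s +ℕ t)) (λ p → T (suc (s +ℕ t)) (suc p)))
  ∑⋯∑⋯≈∑<∑< n s T = trans (reflexive (∑⋯≡∑< (suc s) n (λ a → ∑[_⋯_] R 1 (suc n ∸ a) (T a))))
                          (∑<-cong (n ∸ s) (λ t _ → reflexive (∑⋯≡∑< 1 (n ∸ (s +ℕ t)) (T (suc (s +ℕ t))))))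

  summand : (ℕ → Carrier) → ℕ → ℕ → ℕ → ℕ → ℕ → Carrier
  summand f n m₀ h a j =
    esym R (h +ℕ a ∸ m₀) (map f [ j +ℕ 1 ⋯ j +ℕ a ∸ 1 ]) *
    esymℤ R (+ n -ℤ + (h +ℕ 1 +ℕ a)) (map f [ j +ℕ a +ℕ 1 ⋯ n ] ++ map f [ 1 ⋯ j ∸ 1 ])

  summand≈∑-gapProduct : ∀ (f : ℕ → Carrier) h r {n} p t → p < n ∸ (r +ℕ t) →
    summand f (suc n) (suc (h +ℕ r)) h (suc (r +ℕ t)) (suc p)
      ≈ ∑< (suc h) (λ i → gapProduct (h ∸ i) r i (map f [ 1 ⋯ suc n ]) p (r +ℕ t))
  summand≈∑-gapProduct f h r p t p< with m<n∸o⇒∃[w]n≡m+[1+o]+w p (r +ℕ t) p<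
  ... | w , ≡.refl = begin
      summand f (suc n) (suc (h +ℕ r)) h (suc b) (suc p)
    ≈⟨ *-cong (esym≈coesym (map f middle) r _ length-middle)
              (esymℤ≈coesym (map f after ++ map f before) length-rest) ⟩
      coesym r (map f middle) * coesym h (map f after ++ map f before)
    ≡⟨ ≡.cong₂ (λ B A → coesym r B * coesym h A) middle-slice (≡.cong₂ _++_ after-slice before-slice) ⟩
      coesym r (take b M) * coesym h (drop (suc b) M ++ take p L)
    ≈⟨ *-congˡ (coesym-++ h (drop (suc b) M) (take p L)) ⟩
      coesym r (take b M) * ∑< (suc h) (λ i → coesym i (drop (suc b) M) * coesym (h ∸ i) (take p L))
    ≈⟨ *-distribˡ-∑< (suc h) (coesym r (take b M)) (λ i → coesym i (drop (suc b) M) * coesym (h ∸ i) (take p L)) ⟩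
      ∑< (suc h) (λ i → coesym r (take b M) * (coesym i (drop (suc b) M) * coesym (h ∸ i) (take p L)))
    ≈⟨ ∑<-cong (suc h) (λ i _ → rotate (coesym r (take b M)) (coesym i (drop (suc b) M)) (coesym (h ∸ i) (take p L))) ⟩
      ∑< (suc h) (λ i → gapProduct (h ∸ i) r i L p b)
    ∎
    where
    b = r +ℕ t
    n = p +ℕ suc b +ℕ w
    L = map f [ 1 ⋯ suc n ]
    M = drop (suc p) L
    middle = [ suc p +ℕ 1 ⋯ p +ℕ suc b ]
    after  = [ suc p +ℕ suc b +ℕ 1 ⋯ suc n ]
    before = [ 1 ⋯ p ]

    rotate : ∀ x y z → x * (y * z) ≈ z * (x * y)
    rotate x y z = trans (sym (*-assoc x y z)) (*-comm (x * y) z)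

    middle-end : ∀ p b → suc (p +ℕ suc b) ≡ suc p +ℕ 1 +ℕ b
    middle-end = solve-∀
    after-end : ∀ p b w → suc (suc (p +ℕ suc b +ℕ w)) ≡ suc p +ℕ suc b +ℕ 1 +ℕ w
    after-end = solve-∀
    degree-shift : ∀ h r t → h +ℕ suc (r +ℕ t) ≡ suc (h +ℕ r) +ℕ t
    degree-shift = solve-∀
    rest-count : ∀ p b w h → w +ℕ p +ℕ (h +ℕ 1 +ℕ suc b) ≡ suc (p +ℕ suc b +ℕ w) +ℕ h
    rest-count = solve-∀

    middle≤ : p +ℕ suc b ≤ suc n
    middle≤ = ℕₚ.m≤n⇒m≤1+n (ℕₚ.m≤m+n (p +ℕ suc b) w)

    length-middle : length (map f middle) ≡ r +ℕ (h +ℕ suc b ∸ suc (h +ℕ r))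
    length-middle =
      ≡.trans (length-map-⋯ f {suc p +ℕ 1} {p +ℕ suc b} (middle-end p b)) (≡.cong (r +ℕ_) (≡.sym degree))
      where
      degree : h +ℕ suc b ∸ suc (h +ℕ r) ≡ t
      degree = ≡.trans (≡.cong (_∸ suc (h +ℕ r)) (degree-shift h r t)) (ℕₚ.m+n∸m≡n (suc (h +ℕ r)) t)

    length-rest : length (map f after ++ map f before) +ℕ (h +ℕ 1 +ℕ suc b) ≡ suc n +ℕ h
    length-rest = ≡.trans (≡.cong (_+ℕ (h +ℕ 1 +ℕ suc b)) (≡.trans (length-++ (map f after)) lengths))
                          (rest-count p b w h)
      where
      lengths : length (map f after) +ℕ length (map f before) ≡ w +ℕ p
      lengths = ≡.cong₂ _+ℕ_ (length-map-⋯ f {suc p +ℕ suc b +ℕ 1} {suc n} (after-end p b w))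
                             (length-map-⋯ f {1} {p} ≡.refl)

    middle-slice : map f middle ≡ take b M
    middle-slice = ≡.sym (≡.trans (≡.cong (take b) (drop-map-⋯ f (suc p) 1 (suc n)))
                                  (take-map-⋯ f {suc p +ℕ 1} (middle-end p b) middle≤))

    after-slice : map f after ≡ drop (suc b) M
    after-slice =
      ≡.sym (≡.trans (drop-drop (suc p) (suc b) L) (drop-map-⋯ f (suc p +ℕ suc b) 1 (suc n)))

    before-slice : map f before ≡ take p L
    before-slice = ≡.sym (take-map-⋯ f {1} ≡.refl (ℕₚ.≤-trans (ℕₚ.m≤m+n p (suc b)) middle≤))

lemma7p2 : {c ℓ : Level} (R : CommutativeRing c ℓ) (n m₀ : ℕ) → 1 ≤ n → 1 ≤ m₀ → m₀ < n →
    (x : Fin n → CommutativeRing.Carrier R) → (h : ℕ) → h ≤ m₀ ∸ 1 →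
    CommutativeRing._≈_ R
      (_·_ R (suc h) (esym R (n ∸ m₀ ∸ 1) (xs[_⋯_] R x 1 n)))
      (∑[_⋯_] R (m₀ ∸ h) (n ∸ 1) (λ a → ∑[_⋯_] R 1 (n ∸ a) (λ j →
        CommutativeRing._*_ R
          (esym R ((h +ℕ a) ∸ m₀) (xs[_⋯_] R x (j +ℕ 1) (j +ℕ a ∸ 1)))
          (esymℤ R (+ n -ℤ + (h +ℕ 1 +ℕ a))
             (xs[_⋯_] R x (j +ℕ a +ℕ 1) n ++ xs[_⋯_] R x 1 (j ∸ 1))))))
lemma7p2 R (suc n) (suc m) _ _ (s≤s m<n) x h h≤m with ℕₚ.m≤n⇒∃[o]m+o≡n h≤m
... | r , ≡.refl = begin
    _·_ R (suc h) (esym R (suc n ∸ m₀ ∸ 1) L)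
  ≈⟨ ·-congʳ (suc h) (esym≈coesym L (suc m₀) _ (≡.trans length-L (m<n⇒1+n≡2+m+[n∸m∸1] m<n))) ⟩
    _·_ R (suc h) (coesym (suc m₀) L)
  ≈⟨ sym (∑-gapProduct≈·coesym h r L length-L) ⟩
    ∑< (suc h) (λ i → ∑△ n (λ b p → gapProduct (h ∸ i) r i L p b))
  ≈⟨ ∑<-cong (suc h) (λ i _ → ∑<-skip-zeros _ r≤n (λ b b<r →
       ∑<-zero (n ∸ b) (λ p _ → gapProduct-short (h ∸ i) r i L p b<r))) ⟩
    ∑< (suc h) (λ i → ∑< (n ∸ r) (λ t → ∑< (n ∸ (r +ℕ t)) (G i t)))
  ≈⟨ trans (∑<-comm (suc h) (n ∸ r) (λ i t → ∑< (n ∸ (r +ℕ t)) (G i t)))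
           (∑<-cong (n ∸ r) (λ t _ → ∑<-comm (suc h) (n ∸ (r +ℕ t)) (λ i → G i t))) ⟩
    ∑< (n ∸ r) (λ t → ∑< (n ∸ (r +ℕ t)) (λ p → ∑< (suc h) (λ i → G i t p)))
  ≈⟨ ∑<-cong (n ∸ r) (λ t _ → ∑<-cong (n ∸ (r +ℕ t)) (λ p p< → sym (summand≈∑-gapProduct f h r p t p<))) ⟩
    ∑< (n ∸ r) (λ t → ∑< (n ∸ (r +ℕ t)) (λ p → term (suc (r +ℕ t)) (suc p)))
  ≈⟨ sym (∑⋯∑⋯≈∑<∑< n r term) ⟩
    ∑[_⋯_] R (suc r) n (λ a → ∑[_⋯_] R 1 (suc n ∸ a) (term a))
  ≡⟨ ≡.cong (λ s → ∑[_⋯_] R s n (λ a → ∑[_⋯_] R 1 (suc n ∸ a) (term a))) (≡.sym first-a) ⟩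
    ∑[_⋯_] R (m₀ ∸ h) n (λ a → ∑[_⋯_] R 1 (suc n ∸ a) (term a))
  ∎
  where
  open CommutativeRing R using (sym; trans)
  open ElementarySymmetric R
  open import Relation.Binary.Reasoning.Setoid (CommutativeRing.setoid R)
  f = at R x
  m₀ = suc (h +ℕ r)
  L = map f [ 1 ⋯ suc n ]
  term : ℕ → ℕ → CommutativeRing.Carrier R
  term = summand f (suc n) m₀ h
  G : ℕ → ℕ → ℕ → CommutativeRing.Carrier R
  G i t p = gapProduct (h ∸ i) r i L p (r +ℕ t)
  length-L : length L ≡ suc n
  length-L = length-map-⋯ f {1} {suc n} ≡.refl
  r≤n : r ≤ n
  r≤n = ℕₚ.≤-trans (ℕₚ.m≤n+m r h) (ℕₚ.<⇒≤ m<n)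
  first-a : m₀ ∸ h ≡ suc r
  first-a = ≡.trans (≡.cong (_∸ h) (≡.sym (ℕₚ.+-suc h r))) (ℕₚ.m+n∸m≡n h (suc r))
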